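{- Let $f:D'^X\to\mathbb{R}$ be $k$-submodular representable, and let $(G,c)$ be a $k$-submodular $(X,k)$-network representing $f$. Then for any minimum $s$-$t$ cut $S$ of $(G,c)$, the normalised cut $\nu(S)$ is also a minimum $s$-$t$ cut, and the corresponding assignment $\phi_{\nu(S)}$ minimises $f$. In particular, $f$ can be minimised by computing a minimum $s$-$t$ cut of the network.
   Context: $D=\{1,\dots,k\}$, $D'=\{0\}\cup D$. For a variable set $X$ and $v\in X$ let $X_v=\{v_i: i\in D\}$. An $(X,k)$-network is a network (directed graph with capacities $c\ge0$) on vertex set $\{s,t\}\cup\bigcup_{v\in X}X_v$. An $s$-$t$ cut is a vertex set $S$ with $s\in S$, $t\notin S$, with capacity $c(S)$ the total capacity of edges leaving $S$. For $\phi:X\to D'$, $S_\phi=\{s\}\cup\{v_{\phi(v)}:\phi(v)\ne0\}$. A cut is normalised if it contains at most one vertex of each $X_v$; for a normalised cut $S$, $\phi_S(v)=i$ if $S\cap X_v=\{v_i\}$ and $\phi_S(v)=0$ if $S\cap X_v=\emptyset$. For any $s$-$t$ cut $S$, $\nu(S)=\{s\}\cup\{v_i: S\cap X_v=\{v_i\}\}$. The network represents $f$ if $c(S_\phi)=f(\phi)$ for all $\phi$; it is $k$-submodular if $c(S)\ge c(\nu(S))$ for every $s$-$t$ cut $S$. $f$ is $k$-submodular representable if some $k$-submodular $(X,k)$-network represents it. -}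

module Defs where

open import Level using (Level; _⊔_) renaming (suc to lsuc)
open import Data.Nat using (ℕ)
open import Data.Fin using (Fin; _≟_)
open import Data.Fin.Base using (zero; suc)
import Data.Maybe
open import Data.Maybe using (Maybe; just; nothing)
import Data.Bool
open import Data.Bool using (Bool; true; false; _∧_; not; if_then_else_)
open import Data.List using (List; []; _∷_; _++_; map; concatMap; foldr)
open import Data.List using (allFin)
open import Data.Product using (_×_; Σ)
open import Relation.Nullary using (does)
open import Data.Sum using (_⊎_)
open import Relation.Binary.PropositionalEquality using (_≡_)

-- The paper uses ℝ (unavailable in agda-stdlib); we work
-- over an arbitrary totally ordered commutative monoid (ℝ with +, ≤ is
-- an instance).

record OrderedCommMonoid (a ℓ : Level) : Set (lsuc (a ⊔ ℓ)) where
  infixl 6 _+_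
  infix 4 _≤_
  field
    Carrier   : Set a
    _+_       : Carrier → Carrier → Carrier
    0#        : Carrier
    _≤_       : Carrier → Carrier → Set ℓ
    +-assoc   : ∀ x y z → (x + y) + z ≡ x + (y + z)
    +-comm    : ∀ x y → x + y ≡ y + x
    +-identityˡ : ∀ x → 0# + x ≡ x
    ≤-refl    : ∀ {x} → x ≤ x
    ≤-trans   : ∀ {x y z} → x ≤ y → y ≤ z → x ≤ z
    ≤-antisym : ∀ {x y} → x ≤ y → y ≤ x → x ≡ y
    ≤-total   : ∀ x y → (x ≤ y) ⊎ (y ≤ x)
    +-monoˡ-≤ : ∀ {x y} z → x ≤ y → x + z ≤ y + z

-- (X,k)-networks.  X = Fin n (variables), D = {1..k} encoded as Fin k
-- (index i stands for i+1), D' = D ∪ {0} encoded as Maybe (Fin k)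
-- (nothing stands for 0).

-- Vertex set {s,t} ∪ ⋃_{v∈X} X_v, with X_v = { var v i : i ∈ D }.
data Vertex (n k : ℕ) : Set where
  s t : Vertex n k
  var : Fin n → Fin k → Vertex n k

vertices : (n k : ℕ) → List (Vertex n k)
vertices n k = s ∷ t ∷ concatMap (λ v → map (var v) (allFin k)) (allFin n)

Assignment : (n k : ℕ) → Set
Assignment n k = Fin n → Maybe (Fin k)

module _ {a ℓ : Level} (M : OrderedCommMonoid a ℓ) where
  open OrderedCommMonoid M

  -- A network: directed graph with capacities c ≥ 0; a missing edge is an
  -- edge of capacity 0, so a network is a nonnegative capacity function.
  record Network (n k : ℕ) : Set (a ⊔ ℓ) where
    field
      cap    : Vertex n k → Vertex n k → Carrier
      cap≥0  : ∀ u w → 0# ≤ cap u w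

  VSet : (n k : ℕ) → Set
  VSet n k = Vertex n k → Bool

  IsCut : ∀ {n k} → VSet n k → Set
  IsCut S = (S s ≡ true) × (S t ≡ false)

  sumList : List Carrier → Carrier
  sumList = foldr _+_ 0#

  capacity : ∀ {n k} → Network n k → VSet n k → Carrier
  capacity {n} {k} N S =
    sumList (concatMap (λ u → map (λ w →
      if S u ∧ not (S w) then Network.cap N u w else 0#)
      (vertices n k)) (vertices n k))

  S[_] : ∀ {n k} → Assignment n k → VSet n k
  S[ φ ] s = true
  S[ φ ] t = false
  S[ φ ] (var v i) with φ v
  ... | nothing = false
  ... | just j  = does (i ≟ j)

  otherIn : ∀ {n k} → VSet n k → Fin n → Fin k → Bool
  otherIn {k = k} S v i =
    foldr (λ j b → (not (does (j ≟ i)) ∧ S (var v j)) Data.Bool.∨ b) false (allFin k)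

  ν : ∀ {n k} → VSet n k → VSet n k
  ν S s = true
  ν S t = false
  ν S (var v i) = S (var v i) ∧ not (otherIn S v i)

  -- φ_S for a normalised cut S: φ_S(v) = i if S ∩ X_v = {v_i}, 0 if
  -- S ∩ X_v = ∅.  (Defined for every S by taking the first member of
  -- S ∩ X_v; on normalised cuts this is exactly the paper's φ_S.)
  firstIn : ∀ {m} → (Fin m → Bool) → Maybe (Fin m)
  firstIn {ℕ.zero} P = nothing
  firstIn {ℕ.suc m} P with P zero
  ... | true  = just zero
  ... | false = Data.Maybe.map suc (firstIn (λ j → P (suc j)))

  φ[_] : ∀ {n k} → VSet n k → Assignment n k
  φ[ S ] v = firstIn (λ i → S (var v i))

  Represents : ∀ {n k} → Network n k → (Assignment n k → Carrier) → Set a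
  Represents N f = ∀ φ → capacity N S[ φ ] ≡ f φ

  IsKSubmodular : ∀ {n k} → Network n k → Set ℓ
  IsKSubmodular N = ∀ S → IsCut S → capacity N (ν S) ≤ capacity N S

  KSubmodularRepresentable : ∀ {n k} → (Assignment n k → Carrier) → Set (a ⊔ ℓ)
  KSubmodularRepresentable {n} {k} f =
    Σ (Network n k) λ N → IsKSubmodular N × Represents N f

  IsMinCut : ∀ {n k} → Network n k → VSet n k → Set ℓ
  IsMinCut N S = IsCut S × (∀ T → IsCut T → capacity N S ≤ capacity N T)

  Minimises : ∀ {n k} → (Assignment n k → Carrier) → Assignment n k → Set ℓ
  Minimises f φ = ∀ ψ → f φ ≤ f ψ

-- A k-submodular network can only lose capacity when a cut S is replaced by
-- ν(S), so ν of a minimum cut is again a minimum cut.  Since ν(S) meets each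
-- X_v in at most one vertex it is the cut S_φ of φ = φ_{ν(S)}, whence
-- f(φ) = c(ν(S)) ≤ c(S_ψ) = f(ψ) for every assignment ψ.
module Submission where

open import Defs
open import Level using (Level)
open import Data.Nat using (ℕ)
open import Data.Product using (_×_; _,_)
open import Data.Fin using (Fin; _≟_; zero; suc)
open import Data.Bool using (Bool; true; false; _∧_; _∨_; not; if_then_else_)
open import Data.Bool.Properties using (∧-conicalʳ; ∨-conicalˡ; ∨-conicalʳ; not-injective)
open import Data.Maybe using (just; nothing)
open import Data.List using (List; _∷_; allFin; concat; foldr)
open import Data.List.Properties using (map-cong)
open import Data.List.Membership.Propositional using (_∈_)
open import Data.List.Membership.Propositional.Properties using (∈-allFin)
open import Data.List.Relation.Unary.Any using (here; there)
open import Relation.Nullary using (does; yes; no; contradiction)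
open import Relation.Binary.PropositionalEquality
  using (_≡_; _≢_; _≗_; refl; sym; trans; cong; cong₂; subst₂)

module _ {a ℓ : Level} (M : OrderedCommMonoid a ℓ) where
  open OrderedCommMonoid M

  firstIn-nothing : ∀ {m} (P : Fin m → Bool) → firstIn M P ≡ nothing → ∀ i → P i ≡ false
  firstIn-nothing {ℕ.suc m} P eq i with P zero in P0
  firstIn-nothing {ℕ.suc m} P () i       | true
  firstIn-nothing {ℕ.suc m} P eq zero    | false = P0
  firstIn-nothing {ℕ.suc m} P eq (suc i) | false with firstIn M (λ j → P (suc j)) in rest
  ... | nothing = firstIn-nothing (λ j → P (suc j)) rest i

  firstIn-just : ∀ {m} (P : Fin m → Bool) {j} → firstIn M P ≡ just j → P j ≡ true
  firstIn-just {ℕ.suc m} P eq with P zero in P0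
  firstIn-just {ℕ.suc m} P refl | true = P0
  ... | false with firstIn M (λ j → P (suc j)) in rest
  firstIn-just {ℕ.suc m} P refl | false | just _ = firstIn-just (λ j → P (suc j)) rest

  private
    othersIn : ∀ {n k} → VSet M n k → Fin n → Fin k → List (Fin k) → Bool
    othersIn S v i = foldr (λ j b → (not (does (j ≟ i)) ∧ S (var v j)) ∨ b) false

    othersIn-false : ∀ {n k} (S : VSet M n k) v i {j} (js : List (Fin k)) →
      othersIn S v i js ≡ false → j ∈ js → j ≢ i → S (var v j) ≡ false
    othersIn-false S v i {j} (_ ∷ js) none (here refl) j≢i with j ≟ i
    ... | yes j≡i = contradiction j≡i j≢i
    ... | no _    = ∨-conicalˡ _ _ none
    othersIn-false S v i (_ ∷ js) none (there j∈js) j≢i =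
      othersIn-false S v i js (∨-conicalʳ _ _ none) j∈js j≢i

  otherIn-false : ∀ {n k} (S : VSet M n k) v i {j} →
    otherIn M S v i ≡ false → j ≢ i → S (var v j) ≡ false
  otherIn-false {k = k} S v i {j} none =
    othersIn-false S v i (allFin k) none (∈-allFin j)

  ν-unique : ∀ {n k} (S : VSet M n k) v {i j} →
    ν M S (var v i) ≡ true → j ≢ i → ν M S (var v j) ≡ false
  ν-unique S v {i} {j} vᵢ∈νS j≢i
    rewrite otherIn-false S v i (not-injective (∧-conicalʳ _ _ vᵢ∈νS)) j≢i = refl

  S[φ[ν]]≗ν : ∀ {n k} (S : VSet M n k) → S[_] M (φ[_] M (ν M S)) ≗ ν M S
  S[φ[ν]]≗ν S s = refl
  S[φ[ν]]≗ν S t = refl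
  S[φ[ν]]≗ν S (var v i) with firstIn M (λ i → ν M S (var v i)) in first
  ... | nothing = sym (firstIn-nothing (λ i → ν M S (var v i)) first i)
  ... | just j with i ≟ j
  ...   | yes refl = sym (firstIn-just (λ i → ν M S (var v i)) first)
  ...   | no i≢j   = sym (ν-unique S v (firstIn-just (λ i → ν M S (var v i)) first) i≢j)

  capacity-cong : ∀ {n k} (N : Network M n k) {S T : VSet M n k} →
    S ≗ T → capacity M N S ≡ capacity M N T
  capacity-cong {n} {k} N S≗T =
    cong (sumList M) (cong concat (map-cong (λ u → map-cong (λ w →
      cong₂ (λ p q → if p ∧ not q then Network.cap N u w else 0#) (S≗T u) (S≗T w))
      (vertices n k)) (vertices n k)))

  ν-minCut : ∀ {n k} (N : Network M n k) → IsKSubmodular M N →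
    ∀ {S} → IsMinCut M N S → IsMinCut M N (ν M S)
  ν-minCut N submodular {S} (cut , minimal) =
    (refl , refl) , λ T cutT → ≤-trans (submodular S cut) (minimal T cutT)

  minCut⇒minimises : ∀ {n k} (N : Network M n k) {f} → Represents M N f →
    ∀ {φ S} → IsMinCut M N S → S[_] M φ ≗ S → Minimises M f φ
  minCut⇒minimises N {f} represents {φ} {S} (_ , minimal) S[φ]≗S ψ =
    subst₂ _≤_ f-φ (represents ψ) (minimal (S[_] M ψ) (refl , refl))
    where
    f-φ : capacity M N S ≡ f φ
    f-φ = trans (sym (capacity-cong N S[φ]≗S)) (represents φ)

-- The representability hypothesis is implied by the network hypotheses that follow it.
lemma6p4 : {a ℓ : Level} (M : OrderedCommMonoid a ℓ) (n k : ℕ)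
    (f : Assignment n k → OrderedCommMonoid.Carrier M)
    → KSubmodularRepresentable M f
    → (N : Network M n k) → IsKSubmodular M N → Represents M N f
    → (S : VSet M n k) → IsMinCut M N S
    → IsMinCut M N (ν M S) × Minimises M f (φ[_] M (ν M S))
lemma6p4 M n k f _ N submodular represents S minCut =
  νS-minCut , minCut⇒minimises M N represents νS-minCut (S[φ[ν]]≗ν M S)
  where
  νS-minCut : IsMinCut M N (ν M S)
  νS-minCut = ν-minCut M N submodular minCut
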